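{- Let $(W,S)$ be a Coxeter system, $H\subseteq S$, $s,t\in S$ with $s\ne t$, and $x\in{}^{\{s,t\}}W$. Then the intersection $(W_{\{s,t\}}\cdot x)\cap W^H$ is one of the following sets: (1) $\emptyset$; (2) $\{x\}$; (3) $\{g\cdot x: g\in W_{\{s,t\}},\ t\notin D_R(g)\}$; (4) $\{g\cdot x: g\in W_{\{s,t\}},\ s\notin D_R(g)\}$; (5) $W_{\{s,t\}}\cdot x$.
   Context: $(W,S)$ is a Coxeter system with length function $\ell$; $D_L(w)=\{r\in S:\ell(rw)<\ell(w)\}$, $D_R(w)=\{r\in S:\ell(wr)<\ell(w)\}$. For $J\subseteq S$, $W_J$ is the parabolic subgroup generated by $J$, $W^J=\{w\in W: D_R(w)\subseteq S\setminus J\}$ and ${}^JW=\{w\in W: D_L(w)\subseteq S\setminus J\}$. The notation $g\cdot x$ denotes the product $gx$ when $\ell(gx)=\ell(g)+\ell(x)$ (which holds for all $g\in W_{\{s,t\}}$ when $x\in{}^{\{s,t\}}W$); $W_{\{s,t\}}\cdot x=\{g\cdot x: g\in W_{\{s,t\}}\}$. -}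

module Defs where

open import Level using (0ℓ)
open import Algebra.Bundles using (Group)
open import Algebra.Morphism.Structures using (module GroupMorphisms)
open import Data.Nat using (ℕ; zero; suc; _+_; _<_; _≤_)
open import Data.List using (List; []; _∷_; length)
open import Data.List.Relation.Unary.All using (All)
open import Data.Product using (Σ; ∃; _×_; _,_)
open import Data.Sum using (_⊎_)
open import Relation.Binary.PropositionalEquality using (_≡_)
open import Relation.Nullary using (¬_)

pow : (G : Group 0ℓ 0ℓ) → Group.Carrier G → ℕ → Group.Carrier G
pow G g zero    = Group.ε G
pow G g (suc n) = Group._∙_ G g (pow G g n)

-- A Coxeter system (W,S): W a group, S ⊆ W given as an injective family
-- gen : Gen → W of involutions generating W, such that W has the Coxeter
-- presentation  < S | s² = 1, (st)^{m(s,t)} = 1 >  with m(s,t) the order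
-- of st in W (universal property of the presentation; the relations
-- (st)^n = 1 for all n with (st)^n = 1 in W are exactly the consequences
-- of (st)^{m(s,t)} = 1, and m(s,t) = ∞ imposes no relation).
record CoxeterSystem : Set₁ where
  field
    W   : Group 0ℓ 0ℓ
    Gen : Set
  open Group W
  field
    gen        : Gen → Carrier
    gen-inj    : ∀ {s t} → gen s ≈ gen t → s ≡ t
    gen-invol  : ∀ s → gen s ∙ gen s ≈ ε
    gen-nontriv : ∀ s → ¬ (gen s ≈ ε)
    generates  : ∀ w → Σ (List Gen) λ ws →
                   w ≈ Data.List.foldr (λ r u → gen r ∙ u) ε ws
    universal  : (G : Group 0ℓ 0ℓ) (f : Gen → Group.Carrier G) →
                   (∀ s → Group._≈_ G (Group._∙_ G (f s) (f s)) (Group.ε G)) →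
                   (∀ s t n → pow W (gen s ∙ gen t) n ≈ ε →
                      Group._≈_ G (pow G (Group._∙_ G (f s) (f t)) n) (Group.ε G)) →
                   Σ (Carrier → Group.Carrier G) λ φ →
                     GroupMorphisms.IsGroupHomomorphism (Group.rawGroup W) (Group.rawGroup G) φ
                     × (∀ s → Group._≈_ G (φ (gen s)) (f s))

module Coxeter (C : CoxeterSystem) where
  open CoxeterSystem C public
  open Group W public

  eval : List Gen → Carrier
  eval = Data.List.foldr (λ r u → gen r ∙ u) ε

  IsLength : Carrier → ℕ → Set
  IsLength w n = (Σ (List Gen) λ ws → length ws ≡ n × w ≈ eval ws)
               × (∀ ws → w ≈ eval ws → n ≤ length ws)

  LenLt : Carrier → Carrier → Set
  LenLt u v = ∃ λ m → ∃ λ n → IsLength u m × IsLength v n × m < n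

  InDL : Gen → Carrier → Set
  InDL r w = LenLt (gen r ∙ w) w

  InDR : Gen → Carrier → Set
  InDR r w = LenLt (w ∙ gen r) w

  InParabolic : (Gen → Set) → Carrier → Set
  InParabolic J w = Σ (List Gen) λ ws → All J ws × w ≈ eval ws

  -- W^J and ^J W
  InMinRight : (Gen → Set) → Carrier → Set
  InMinRight J w = ∀ r → J r → ¬ InDR r w

  InMinLeft : (Gen → Set) → Carrier → Set
  InMinLeft J w = ∀ r → J r → ¬ InDL r w

  Pair : Gen → Gen → Gen → Set
  Pair s t r = r ≡ s ⊎ r ≡ t

  Reduced : Carrier → Carrier → Set
  Reduced g x = ∃ λ a → ∃ λ b → IsLength g a × IsLength x b × IsLength (g ∙ x) (a + b)

  IsDot : Carrier → Carrier → Carrier → Set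
  IsDot w g x = w ≈ g ∙ x × Reduced g x

  InDotCoset : Gen → Gen → Carrier → Carrier → Set
  InDotCoset s t x w = ∃ λ g → InParabolic (Pair s t) g × IsDot w g x

  InDotCosetNoDR : Gen → Gen → Gen → Carrier → Carrier → Set
  InDotCosetNoDR s t r x w =
    ∃ λ g → InParabolic (Pair s t) g × ¬ InDR r g × IsDot w g x

  SameSet : (Carrier → Set) → (Carrier → Set) → Set
  SameSet P Q = ∀ w → (P w → Q w) × (Q w → P w)

module Submission where

open import Defs
open import Level using (0ℓ)
open import Axiom.ExcludedMiddle using (ExcludedMiddle)
open import Algebra.Bundles using (Group)
open import Algebra.Structures using (IsGroup)
open import Data.Bool using (Bool; true; false; _xor_)
open import Data.Bool.Properties using (xor-assoc; xor-same; xor-identityʳ)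
open import Data.List using (List; []; _∷_; _++_; [_]; length; reverse)
open import Data.List.Properties using (∷-injective; unfold-reverse; length-++; length-reverse; reverse-++; reverse-involutive; ++-assoc)
open import Data.List.Relation.Unary.All as All using (All; []; _∷_)
open import Data.List.Relation.Unary.All.Properties using (++⁺; ++⁻)
open import Data.List.Relation.Unary.Any.Properties using (reverse⁻)
open import Data.List.Reverse using ([]; _∶_∶ʳ_; reverseView)
open import Data.Nat using (ℕ; zero; suc; _+_; _≤_; _<_; s≤s)
open import Data.Nat.Induction using (<-rec)
open import Data.Nat.Properties
open import Data.Product using (Σ; _×_; _,_; proj₁; proj₂)
open import Data.Sum using (_⊎_; inj₁; inj₂; [_,_]′)
open import Relation.Binary.PropositionalEquality as ≡ using (_≡_; _≢_; refl; cong; cong₂; subst; subst₂)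
open import Data.Empty using (⊥; ⊥-elim)
open import Relation.Nullary using (Dec; yes; no; ¬_; does)

-- Idea: for g ∈ W_{s,t} the right descents h ∈ H of g·x are the right
-- descents of x in H together with those h for which x h x⁻¹ = r ∈ {s,t} and
-- r is a right descent of g.  So either x has a right descent in H and the
-- intersection is empty, or g·x ∈ W^H iff g has no right descent among the
-- generators of {s,t} "hit" as some x h x⁻¹; the four possible sets of hit
-- generators give the remaining four cases.
--
-- Excluded middle, a
-- hypothesis of the statement, gives the cocycle its truth values and the
-- length function its least elements.

module Conjugation {c ℓ} (G : Group c ℓ) where
  open Group G renaming (refl to ≈-refl; sym to ≈-sym; trans to ≈-trans)
  open import Algebra.Properties.Group G
  open import Relation.Binary.Reasoning.Setoid setoid

  conj : Carrier → Carrier → Carrier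
  conj a u = a ⁻¹ ∙ u ∙ a

  conj-cong : ∀ {a a' u u'} → a ≈ a' → u ≈ u' → conj a u ≈ conj a' u'
  conj-cong e f = ∙-cong (∙-cong (⁻¹-cong e) f) e

  conj-ε : ∀ u → conj ε u ≈ u
  conj-ε u = begin
    ε ⁻¹ ∙ u ∙ ε ≈⟨ identityʳ _ ⟩
    ε ⁻¹ ∙ u     ≈⟨ ∙-congʳ ε⁻¹≈ε ⟩
    ε ∙ u        ≈⟨ identityˡ u ⟩
    u            ∎

  conj-self : ∀ a → conj a a ≈ a
  conj-self a = ≈-trans (∙-congʳ (inverseˡ a)) (identityˡ a)

  ∙-conj : ∀ a u → u ∙ a ≈ a ∙ conj a u
  ∙-conj a u = ≈-sym (≈-trans (∙-congˡ (assoc _ u a)) (\\-leftDividesˡ a (u ∙ a)))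

  conj-∙ : ∀ a b u → conj (a ∙ b) u ≈ conj b (conj a u)
  conj-∙ a b u = begin
    (a ∙ b) ⁻¹ ∙ u ∙ (a ∙ b)   ≈⟨ ∙-congʳ (∙-congʳ (⁻¹-anti-homo-∙ a b)) ⟩
    b ⁻¹ ∙ a ⁻¹ ∙ u ∙ (a ∙ b)  ≈⟨ ≈-sym (assoc _ a b) ⟩
    b ⁻¹ ∙ a ⁻¹ ∙ u ∙ a ∙ b    ≈⟨ ∙-congʳ (∙-congʳ (assoc _ _ _)) ⟩
    b ⁻¹ ∙ (a ⁻¹ ∙ u) ∙ a ∙ b  ≈⟨ ∙-congʳ (assoc _ _ _) ⟩
    b ⁻¹ ∙ (a ⁻¹ ∙ u ∙ a) ∙ b  ∎

  unconj : ∀ a u → a ∙ conj a u ∙ a ⁻¹ ≈ u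
  unconj a u = begin
    a ∙ (a ⁻¹ ∙ u ∙ a) ∙ a ⁻¹   ≈⟨ ∙-congʳ (≈-sym (assoc a (a ⁻¹ ∙ u) a)) ⟩
    a ∙ (a ⁻¹ ∙ u) ∙ a ∙ a ⁻¹   ≈⟨ assoc _ a (a ⁻¹) ⟩
    a ∙ (a ⁻¹ ∙ u) ∙ (a ∙ a ⁻¹) ≈⟨ ∙-cong (\\-leftDividesˡ a u) (inverseʳ a) ⟩
    u ∙ ε                       ≈⟨ identityʳ u ⟩
    u                           ∎

  conj-unconj : ∀ a v → conj a (a ∙ v ∙ a ⁻¹) ≈ v
  conj-unconj a v = begin
    a ⁻¹ ∙ (a ∙ v ∙ a ⁻¹) ∙ a ≈⟨ ∙-congʳ (≈-sym (assoc (a ⁻¹) (a ∙ v) (a ⁻¹))) ⟩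
    a ⁻¹ ∙ (a ∙ v) ∙ a ⁻¹ ∙ a ≈⟨ ∙-congʳ (∙-congʳ (\\-leftDividesʳ a v)) ⟩
    v ∙ a ⁻¹ ∙ a              ≈⟨ //-rightDividesˡ a v ⟩
    v                         ∎

  conj-⁻¹ : ∀ a u → conj (a ⁻¹) u ≈ a ∙ u ∙ a ⁻¹
  conj-⁻¹ a u = ∙-congʳ (∙-congʳ (⁻¹-involutive a))

  conj-≈⇒ : ∀ {a u v} → conj a u ≈ v → u ≈ a ∙ v ∙ a ⁻¹
  conj-≈⇒ {a} {u} e = ≈-trans (≈-sym (unconj a u)) (∙-congʳ (∙-congˡ e))

  conj-≈⇐ : ∀ {a u v} → u ≈ a ∙ v ∙ a ⁻¹ → conj a u ≈ v
  conj-≈⇐ {a} {u} {v} e = ≈-trans (conj-cong ≈-refl e) (conj-unconj a v)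

-- The semidirect product  W ⋉ 𝔹^W  of a group W with the Boolean group of
-- setoid-respecting labellings W → 𝔹, W acting on labellings by conjugation:
--   (a , φ) (b , ψ) = (a b , u ↦ φ u ⊕ ψ (a⁻¹ u a)).
-- Sending a Coxeter generator r to (r , [· = r]) defines the reflection
-- cocycle, from which the exchange condition is derived.
module SemidirectProduct (W : Group 0ℓ 0ℓ) where
  open Group W renaming (refl to ≈-refl; sym to ≈-sym; trans to ≈-trans)
  open Conjugation W

  record Twisted : Set where
    constructor tw
    field
      base       : Carrier
      label      : Carrier → Bool
      label-resp : ∀ {a b} → a ≈ b → label a ≡ label b
  open Twisted public

  infix 4 _≈ᵗ_
  infixl 7 _∙ᵗ_

  _≈ᵗ_ : Twisted → Twisted → Set
  p ≈ᵗ q = base p ≈ base q × (∀ u → label p u ≡ label q u)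

  _∙ᵗ_ : Twisted → Twisted → Twisted
  tw a φ φ-resp ∙ᵗ tw b ψ ψ-resp =
    tw (a ∙ b) (λ u → φ u xor ψ (conj a u))
       (λ e → cong₂ _xor_ (φ-resp e) (ψ-resp (conj-cong ≈-refl e)))

  εᵗ : Twisted
  εᵗ = tw ε (λ _ → false) (λ _ → ≡.refl)

  _⁻¹ᵗ : Twisted → Twisted
  tw a φ φ-resp ⁻¹ᵗ = tw (a ⁻¹) (λ u → φ (conj (a ⁻¹) u)) (λ e → φ-resp (conj-cong ≈-refl e))

  ≈ᵗ-sym : ∀ {p q} → p ≈ᵗ q → q ≈ᵗ p
  ≈ᵗ-sym (e , f) = ≈-sym e , λ u → ≡.sym (f u)

  ≈ᵗ-trans : ∀ {p q r} → p ≈ᵗ q → q ≈ᵗ r → p ≈ᵗ r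
  ≈ᵗ-trans (e , f) (e' , f') = ≈-trans e e' , λ u → ≡.trans (f u) (f' u)

  ∙ᵗ-cong : ∀ {p p' q q'} → p ≈ᵗ p' → q ≈ᵗ q' → p ∙ᵗ q ≈ᵗ p' ∙ᵗ q'
  ∙ᵗ-cong {tw a φ _} {tw a' φ' _} {tw b ψ ψ-resp} (e , f) (e' , f') =
    ∙-cong e e' , λ u → cong₂ _xor_ (f u) (≡.trans (ψ-resp (conj-cong e ≈-refl)) (f' _))

  twisted-isGroup : IsGroup _≈ᵗ_ _∙ᵗ_ εᵗ _⁻¹ᵗ
  twisted-isGroup = record
    { isMonoid = record
      { isSemigroup = record
        { isMagma = record
          { isEquivalence = record
            { refl = ≈-refl , λ _ → ≡.refl ; sym = λ {p q} → ≈ᵗ-sym {p} {q}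
            ; trans = λ {p q r} → ≈ᵗ-trans {p} {q} {r} }
          ; ∙-cong = λ {p p' q q'} → ∙ᵗ-cong {p} {p'} {q} {q'} }
        ; assoc = λ { (tw a φ _) (tw b ψ _) (tw c χ χ-resp) → assoc a b c , λ u →
             ≡.trans (xor-assoc (φ u) (ψ (conj a u)) (χ (conj (a ∙ b) u)))
                     (cong (λ z → φ u xor (ψ (conj a u) xor z)) (χ-resp (conj-∙ a b u))) } }
      ; identity = (λ { (tw a φ φ-resp) → identityˡ a , λ u → φ-resp (conj-ε u) })
                 , (λ { (tw a φ _) → identityʳ a , λ u → xor-identityʳ (φ u) }) }
    ; inverse = (λ { (tw a φ _) → inverseˡ a , λ u → xor-same (φ (conj (a ⁻¹) u)) })
              , (λ { (tw a φ φ-resp) → inverseʳ a , λ u →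
                    ≡.trans (cong (φ u xor_) (φ-resp (≈-trans (conj-⁻¹ a (conj a u)) (unconj a u))))
                            (xor-same (φ u)) })
    ; ⁻¹-cong = λ { {tw a φ φ-resp} {tw a' φ' _} (e , f) → ⁻¹-cong e , λ u →
                   ≡.trans (φ-resp (conj-cong (⁻¹-cong e) ≈-refl)) (f _) } }

  twisted : Group 0ℓ 0ℓ
  twisted = record { isGroup = twisted-isGroup }

module Classical (lem : ExcludedMiddle 0ℓ) where
  ⟦_⟧ : Set → Bool
  ⟦ A ⟧ = does (lem {A})

  ⟦⟧-iff : {A B : Set} → (A → B) → (B → A) → ⟦ A ⟧ ≡ ⟦ B ⟧
  ⟦⟧-iff {A} {B} f g with lem {A} | lem {B}
  ... | yes _ | yes _  = refl
  ... | no _  | no _   = refl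
  ... | yes a | no ¬b  = ⊥-elim (¬b (f a))
  ... | no ¬a | yes b  = ⊥-elim (¬a (g b))

  ⟦⟧-true : {A : Set} → A → ⟦ A ⟧ ≡ true
  ⟦⟧-true {A} a with lem {A}
  ... | yes _ = refl
  ... | no ¬a = ⊥-elim (¬a a)

  Least : (ℕ → Set) → Set
  Least Q = Σ ℕ λ m → Q m × (∀ k → Q k → m ≤ k)

  least : (Q : ℕ → Set) → ∀ n → Q n → Least Q
  least Q = <-rec (λ n → Q n → Least Q) step
    where
    step : ∀ n → (∀ {k} → k < n → Q k → Least Q) → Q n → Least Q
    step n below qn with lem {Σ ℕ λ k → k < n × Q k}
    ... | yes (k , k<n , qk) = below k<n qk
    ... | no none = n , qn , λ k qk → ≮⇒≥ (λ k<n → none (k , k<n , qk))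

split-++ : {A : Set} (ws xs as : List A) (b : A) (bs : List A) → ws ++ xs ≡ as ++ b ∷ bs →
  (Σ (List A) λ cs → ws ≡ as ++ b ∷ cs × bs ≡ cs ++ xs) ⊎
  (Σ (List A) λ ds → as ≡ ws ++ ds × xs ≡ ds ++ b ∷ bs)
split-++ []       xs as       b bs eq   = inj₂ (as , refl , eq)
split-++ (w ∷ ws) xs []       b bs refl = inj₁ (ws , refl , refl)
split-++ (w ∷ ws) xs (a ∷ as) b bs eq with ∷-injective eq
... | refl , eq' with split-++ ws xs as b bs eq'
...   | inj₁ (cs , p , q) = inj₁ (cs , cong (w ∷_) p , q)
...   | inj₂ (ds , p , q) = inj₂ (ds , cong (w ∷_) p , q)

length-delete : {A : Set} (as : List A) (a : A) (bs : List A) → length (as ++ bs) < length (as ++ a ∷ bs)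
length-delete []       a bs = ≤-refl
length-delete (x ∷ as) a bs = s≤s (length-delete as a bs)

module Words (C : CoxeterSystem) where
  open Coxeter C renaming (refl to ≈-refl; sym to ≈-sym; trans to ≈-trans; reflexive to ≈-reflexive)
  open import Algebra.Properties.Group W
  open import Relation.Binary.Reasoning.Setoid setoid

  gen⁻¹ : ∀ r → gen r ⁻¹ ≈ gen r
  gen⁻¹ r = ≈-sym (inverseʳ-unique (gen r) (gen r) (gen-invol r))

  gen-gen-∙ : ∀ r w → gen r ∙ (gen r ∙ w) ≈ w
  gen-gen-∙ r w = ≈-trans (≈-sym (assoc _ _ _)) (≈-trans (∙-congʳ (gen-invol r)) (identityˡ w))

  eval-++ : ∀ xs ys → eval (xs ++ ys) ≈ eval xs ∙ eval ys
  eval-++ []       ys = ≈-sym (identityˡ _)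
  eval-++ (x ∷ xs) ys = ≈-trans (∙-congˡ (eval-++ xs ys)) (≈-sym (assoc _ _ _))

  -- reading a word backwards inverts its value (generators are involutions)
  eval-reverse : ∀ xs → eval (reverse xs) ≈ eval xs ⁻¹
  eval-reverse []       = ≈-sym ε⁻¹≈ε
  eval-reverse (x ∷ xs) = begin
    eval (reverse (x ∷ xs))        ≡⟨ cong eval (unfold-reverse x xs) ⟩
    eval (reverse xs ++ [ x ])     ≈⟨ eval-++ (reverse xs) [ x ] ⟩
    eval (reverse xs) ∙ (gen x ∙ ε) ≈⟨ ∙-cong (eval-reverse xs) (identityʳ _) ⟩
    eval xs ⁻¹ ∙ gen x             ≈⟨ ∙-congˡ (≈-sym (gen⁻¹ x)) ⟩
    eval xs ⁻¹ ∙ gen x ⁻¹          ≈⟨ ≈-sym (⁻¹-anti-homo-∙ (gen x) (eval xs)) ⟩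
    (gen x ∙ eval xs) ⁻¹           ∎

  right-deletion-in-prefix : ∀ {r x} ws xs as bs cs → x ≈ eval xs →
    eval (ws ++ xs) ∙ gen r ≈ eval as ∙ eval bs → bs ≡ cs ++ xs →
    eval ws ∙ x ∙ gen r ≈ eval (as ++ cs) ∙ x
  right-deletion-in-prefix {r} {x} ws xs as bs cs ex e bs≡ = begin
    eval ws ∙ x ∙ gen r           ≈⟨ ∙-congʳ (≈-trans (∙-congˡ ex) (≈-sym (eval-++ ws xs))) ⟩
    eval (ws ++ xs) ∙ gen r       ≈⟨ e ⟩
    eval as ∙ eval bs             ≈⟨ ∙-congˡ (≈-trans (≈-reflexive (cong eval bs≡)) (eval-++ cs xs)) ⟩
    eval as ∙ (eval cs ∙ eval xs) ≈⟨ ≈-sym (assoc _ _ _) ⟩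
    eval as ∙ eval cs ∙ eval xs   ≈⟨ ∙-cong (≈-sym (eval-++ as cs)) (≈-sym ex) ⟩
    eval (as ++ cs) ∙ x           ∎

  right-deletion-in-suffix : ∀ {r x} ws xs as bs ds → x ≈ eval xs →
    eval (ws ++ xs) ∙ gen r ≈ eval as ∙ eval bs → as ≡ ws ++ ds →
    x ∙ gen r ≈ eval (ds ++ bs)
  right-deletion-in-suffix {r} {x} ws xs as bs ds ex e as≡ =
    ≈-trans (∙-congʳ ex) (≈-trans (∙-cancelˡ (eval ws) _ _ ws∙-) (≈-sym (eval-++ ds bs)))
    where
    ws∙- : eval ws ∙ (eval xs ∙ gen r) ≈ eval ws ∙ (eval ds ∙ eval bs)
    ws∙- = begin
      eval ws ∙ (eval xs ∙ gen r)     ≈⟨ ≈-sym (assoc _ _ _) ⟩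
      eval ws ∙ eval xs ∙ gen r       ≈⟨ ∙-congʳ (≈-sym (eval-++ ws xs)) ⟩
      eval (ws ++ xs) ∙ gen r         ≈⟨ e ⟩
      eval as ∙ eval bs               ≈⟨ ∙-congʳ (≈-trans (≈-reflexive (cong eval as≡)) (eval-++ ws ds)) ⟩
      eval ws ∙ eval ds ∙ eval bs     ≈⟨ assoc _ _ _ ⟩
      eval ws ∙ (eval ds ∙ eval bs)   ∎

  left-deletion-in-prefix : ∀ {r x} ws xs as bs cs → x ≈ eval xs →
    gen r ∙ eval (ws ++ xs) ≈ eval as ∙ eval bs → bs ≡ cs ++ xs →
    gen r ∙ eval ws ≈ eval (as ++ cs)
  left-deletion-in-prefix {r} {x} ws xs as bs cs ex e bs≡ = ∙-cancelʳ x _ _ (begin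
    gen r ∙ eval ws ∙ x            ≈⟨ assoc _ _ _ ⟩
    gen r ∙ (eval ws ∙ x)          ≈⟨ ∙-congˡ (≈-trans (∙-congˡ ex) (≈-sym (eval-++ ws xs))) ⟩
    gen r ∙ eval (ws ++ xs)        ≈⟨ e ⟩
    eval as ∙ eval bs              ≈⟨ ∙-congˡ (≈-trans (≈-reflexive (cong eval bs≡)) (eval-++ cs xs)) ⟩
    eval as ∙ (eval cs ∙ eval xs)  ≈⟨ ≈-sym (assoc _ _ _) ⟩
    eval as ∙ eval cs ∙ eval xs    ≈⟨ ∙-cong (≈-sym (eval-++ as cs)) (≈-sym ex) ⟩
    eval (as ++ cs) ∙ x            ∎)

  left-deletion-in-suffix : ∀ {r x} ws xs as bs ds → x ≈ eval xs →
    gen r ∙ eval (ws ++ xs) ≈ eval as ∙ eval bs → as ≡ ws ++ ds →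
    eval ws ⁻¹ ∙ gen r ∙ eval ws ∙ x ≈ eval (ds ++ bs)
  left-deletion-in-suffix {r} {x} ws xs as bs ds ex e as≡ = begin
    w ⁻¹ ∙ gen r ∙ w ∙ x               ≈⟨ assoc _ _ _ ⟩
    w ⁻¹ ∙ gen r ∙ (w ∙ x)             ≈⟨ assoc _ _ _ ⟩
    w ⁻¹ ∙ (gen r ∙ (w ∙ x))           ≈⟨ ∙-congˡ (∙-congˡ (≈-trans (∙-congˡ ex) (≈-sym (eval-++ ws xs)))) ⟩
    w ⁻¹ ∙ (gen r ∙ eval (ws ++ xs))   ≈⟨ ∙-congˡ e ⟩
    w ⁻¹ ∙ (eval as ∙ eval bs)         ≈⟨ ∙-congˡ (∙-congʳ (≈-trans (≈-reflexive (cong eval as≡)) (eval-++ ws ds))) ⟩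
    w ⁻¹ ∙ (w ∙ eval ds ∙ eval bs)     ≈⟨ ∙-congˡ (assoc _ _ _) ⟩
    w ⁻¹ ∙ (w ∙ (eval ds ∙ eval bs))   ≈⟨ \\-leftDividesʳ w _ ⟩
    eval ds ∙ eval bs                  ≈⟨ ≈-sym (eval-++ ds bs) ⟩
    eval (ds ++ bs)                    ∎
    where
    w = eval ws

module ParabolicSubgroup (C : CoxeterSystem) (J : Coxeter.Gen C → Set) where
  open Coxeter C renaming (refl to ≈-refl; sym to ≈-sym; trans to ≈-trans)
  open Words C

  InWJ : Carrier → Set
  InWJ = InParabolic J

  InWJ-word : ∀ {ws} → All J ws → InWJ (eval ws)
  InWJ-word {ws} p = ws , p , ≈-refl

  InWJ-ε : InWJ ε
  InWJ-ε = InWJ-word []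

  InWJ-gen : ∀ {r} → J r → InWJ (gen r)
  InWJ-gen {r} j = r ∷ [] , j ∷ [] , ≈-sym (identityʳ _)

  InWJ-cong : ∀ {a b} → a ≈ b → InWJ a → InWJ b
  InWJ-cong e (as , pa , ea) = as , pa , ≈-trans (≈-sym e) ea

  InWJ-∙ : ∀ {a b} → InWJ a → InWJ b → InWJ (a ∙ b)
  InWJ-∙ (as , pa , ea) (bs , pb , eb) = as ++ bs , ++⁺ pa pb , ≈-trans (∙-cong ea eb) (≈-sym (eval-++ as bs))

  InWJ-⁻¹ : ∀ {a} → InWJ a → InWJ (a ⁻¹)
  InWJ-⁻¹ (as , pa , ea) =
    reverse as , All.tabulate (λ m → All.lookup pa (reverse⁻ m)) ,
    ≈-trans (⁻¹-cong ea) (≈-sym (eval-reverse as))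

-- The universal property of the Coxeter
-- presentation gives a homomorphism  Φ : W → W ⋉ 𝔹^W  with
-- Φ(r) = (r , [· = r]).  Its label at u, computed on any word ws for w, is
-- the parity  crossings ws u  of the number of indices i with
-- r₁⋯rᵢ₋₁ rᵢ rᵢ₋₁⋯r₁ = u; being a function of w alone it yields the
-- deletion property: a word crossing u oddly loses a letter when multiplied by u.
module ReflectionCocycle (lem : ExcludedMiddle 0ℓ) (C : CoxeterSystem) where
  open Coxeter C renaming (refl to ≈-refl; sym to ≈-sym; trans to ≈-trans; reflexive to ≈-reflexive)
  open import Algebra.Properties.Group W
  open import Relation.Binary.Reasoning.Setoid setoid
  open import Algebra.Morphism.Structures using (module GroupMorphisms)
  open Conjugation W
  open SemidirectProduct W
  open Classical lem
  open Words C

  conj-⟦⟧ : ∀ a u v w → a ∙ v ∙ a ⁻¹ ≈ w → ⟦ conj a u ≈ v ⟧ ≡ ⟦ u ≈ w ⟧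
  conj-⟦⟧ a u v w e = ⟦⟧-iff (λ h → ≈-trans (conj-≈⇒ h) e) (λ h → conj-≈⇐ (≈-trans h (≈-sym e)))

  δ : Gen → Carrier → Bool
  δ r u = ⟦ u ≈ gen r ⟧

  δ-resp : ∀ r {a b} → a ≈ b → δ r a ≡ δ r b
  δ-resp r e = ⟦⟧-iff (≈-trans (≈-sym e)) (≈-trans e)

  gen-image : Gen → Twisted
  gen-image r = tw (gen r) (δ r) (δ-resp r)

  involution-relation : ∀ r → gen-image r ∙ᵗ gen-image r ≈ᵗ εᵗ
  involution-relation r = gen-invol r , λ u →
    ≡.trans (cong (δ r u xor_) (conj-⟦⟧ (gen r) u (gen r) (gen r) (//-rightDividesʳ (gen r) (gen r))))
            (xor-same (δ r u))

  -- The label of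
  -- (Φ(s)Φ(t))ⁿ at u is the parity of the occurrences of u among the 2n
  -- reflections (st)ᵏ s, k < 2n, which cancel in pairs when (st)ⁿ = 1.
  module BraidRelation (s t : Gen) where
    c : Carrier
    c = gen s ∙ gen t

    refl-st : ℕ → Carrier
    refl-st k = pow W c k ∙ gen s

    odd-among : ℕ → ℕ → Carrier → Bool
    odd-among zero    k u = false
    odd-among (suc m) k u = ⟦ u ≈ refl-st k ⟧ xor odd-among m (suc k) u

    twice : ℕ → ℕ
    twice zero    = zero
    twice (suc n) = suc (suc (twice n))

    twice≡ : ∀ n → twice n ≡ n + n
    twice≡ zero    = refl
    twice≡ (suc n) = cong suc (≡.trans (cong suc (twice≡ n)) (≡.sym (+-suc n n)))

    pow-comm : ∀ k → pow W c k ∙ c ≈ c ∙ pow W c k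
    pow-comm zero    = ≈-trans (identityˡ c) (≈-sym (identityʳ c))
    pow-comm (suc k) = ≈-trans (assoc c _ c) (∙-congˡ (pow-comm k))

    pow-+ : ∀ a b → pow W c (a + b) ≈ pow W c a ∙ pow W c b
    pow-+ zero    b = ≈-sym (identityˡ _)
    pow-+ (suc a) b = ≈-trans (∙-congˡ (pow-+ a b)) (≈-sym (assoc c _ _))

    s∙c⁻¹ : gen s ∙ c ⁻¹ ≈ c ∙ gen s
    s∙c⁻¹ = begin
      gen s ∙ c ⁻¹                   ≈⟨ ∙-congˡ (⁻¹-anti-homo-∙ (gen s) (gen t)) ⟩
      gen s ∙ (gen t ⁻¹ ∙ gen s ⁻¹)  ≈⟨ ∙-congˡ (∙-cong (gen⁻¹ t) (gen⁻¹ s)) ⟩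
      gen s ∙ (gen t ∙ gen s)        ≈⟨ ≈-sym (assoc _ _ _) ⟩
      c ∙ gen s                      ∎

    refl-st-shift : ∀ k → c ∙ refl-st k ∙ c ⁻¹ ≈ refl-st (suc (suc k))
    refl-st-shift k = begin
      c ∙ (pow W c k ∙ gen s) ∙ c ⁻¹ ≈⟨ ∙-congʳ (≈-sym (assoc c _ _)) ⟩
      c ∙ pow W c k ∙ gen s ∙ c ⁻¹   ≈⟨ assoc _ _ _ ⟩
      c ∙ pow W c k ∙ (gen s ∙ c ⁻¹) ≈⟨ ∙-congˡ s∙c⁻¹ ⟩
      c ∙ pow W c k ∙ (c ∙ gen s)    ≈⟨ ≈-sym (assoc _ _ _) ⟩
      c ∙ pow W c k ∙ c ∙ gen s      ≈⟨ ∙-congʳ (assoc _ _ _) ⟩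
      c ∙ (pow W c k ∙ c) ∙ gen s    ≈⟨ ∙-congʳ (∙-congˡ (pow-comm k)) ⟩
      c ∙ (c ∙ pow W c k) ∙ gen s    ∎

    odd-among-conj : ∀ m k u → odd-among m k (conj c u) ≡ odd-among m (suc (suc k)) u
    odd-among-conj zero    k u = refl
    odd-among-conj (suc m) k u =
      cong₂ _xor_ (conj-⟦⟧ c u (refl-st k) _ (refl-st-shift k)) (odd-among-conj m (suc k) u)

    odd-among-+ : ∀ a b k u → odd-among (a + b) k u ≡ odd-among a k u xor odd-among b (a + k) u
    odd-among-+ zero    b k u = refl
    odd-among-+ (suc a) b k u =
      ≡.trans (cong (⟦ u ≈ refl-st k ⟧ xor_)
                (≡.trans (odd-among-+ a b (suc k) u)
                         (cong (λ z → odd-among a (suc k) u xor odd-among b z u) (+-suc a k))))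
              (≡.sym (xor-assoc ⟦ u ≈ refl-st k ⟧ _ _))

    module Periodic (n : ℕ) (cⁿ≈ε : pow W c n ≈ ε) where
      refl-st-periodic : ∀ k → refl-st (n + k) ≈ refl-st k
      refl-st-periodic k = ∙-congʳ (≈-trans (pow-+ n k) (≈-trans (∙-congʳ cⁿ≈ε) (identityˡ _)))

      odd-among-periodic : ∀ m k u → odd-among m (n + k) u ≡ odd-among m k u
      odd-among-periodic zero    k u = refl
      odd-among-periodic (suc m) k u =
        cong₂ _xor_ (⟦⟧-iff (λ h → ≈-trans h (refl-st-periodic k)) (λ h → ≈-trans h (≈-sym (refl-st-periodic k))))
                    (≡.trans (cong (λ z → odd-among m z u) (≡.sym (+-suc n k))) (odd-among-periodic m (suc k) u))

      odd-among-vanishes : ∀ u → odd-among (twice n) 0 u ≡ false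
      odd-among-vanishes u =
        ≡.trans (cong (λ z → odd-among z 0 u) (twice≡ n))
        (≡.trans (odd-among-+ n n 0 u)
        (≡.trans (cong (odd-among n 0 u xor_) (odd-among-periodic n 0 u))
                 (xor-same (odd-among n 0 u))))

    p : Twisted
    p = gen-image s ∙ᵗ gen-image t

    label-p : ∀ u → label p u ≡ ⟦ u ≈ refl-st 0 ⟧ xor ⟦ u ≈ refl-st 1 ⟧
    label-p u = cong₂ _xor_ (⟦⟧-iff (λ h → ≈-trans h (≈-sym (identityˡ _))) (λ h → ≈-trans h (identityˡ _)))
                            (conj-⟦⟧ (gen s) u (gen t) (refl-st 1)
                               (≈-trans (∙-congˡ (gen⁻¹ s)) (∙-congʳ (≈-sym (identityʳ c)))))

    base-pow : ∀ n → base (pow twisted p n) ≈ pow W c n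
    base-pow zero    = ≈-refl
    base-pow (suc n) = ∙-congˡ (base-pow n)

    label-pow : ∀ n u → label (pow twisted p n) u ≡ odd-among (twice n) 0 u
    label-pow zero    u = refl
    label-pow (suc n) u =
      ≡.trans (cong₂ _xor_ (label-p u) (≡.trans (label-pow n (conj c u)) (odd-among-conj (twice n) 0 u)))
              (xor-assoc ⟦ u ≈ refl-st 0 ⟧ _ _)

    braid-relation : ∀ n → pow W c n ≈ ε → pow twisted p n ≈ᵗ εᵗ
    braid-relation n cⁿ≈ε =
      ≈-trans (base-pow n) cⁿ≈ε , λ u → ≡.trans (label-pow n u) (Periodic.odd-among-vanishes n cⁿ≈ε u)

  cocycle : Σ (Carrier → Twisted) λ Φ →
              GroupMorphisms.IsGroupHomomorphism (Group.rawGroup W) (Group.rawGroup twisted) Φ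
              × (∀ r → Φ (gen r) ≈ᵗ gen-image r)
  cocycle = universal twisted gen-image involution-relation BraidRelation.braid-relation

  Φ : Carrier → Twisted
  Φ = proj₁ cocycle

  open GroupMorphisms.IsGroupHomomorphism (proj₁ (proj₂ cocycle)) using (homo; ε-homo) renaming (⟦⟧-cong to Φ-cong)

  crossings : List Gen → Carrier → Bool
  crossings []       u = false
  crossings (r ∷ ws) u = δ r u xor crossings ws (conj (gen r) u)

  crossings-resp : ∀ ws {u u'} → u ≈ u' → crossings ws u ≡ crossings ws u'
  crossings-resp []       e = refl
  crossings-resp (r ∷ ws) e = cong₂ _xor_ (δ-resp r e) (crossings-resp ws (conj-cong ≈-refl e))

  word-image : List Gen → Twisted
  word-image ws = tw (eval ws) (crossings ws) (crossings-resp ws)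

  Φ-eval : ∀ ws → Φ (eval ws) ≈ᵗ word-image ws
  Φ-eval []       = ε-homo
  Φ-eval (r ∷ ws) =
    ≈ᵗ-trans {Φ (gen r ∙ eval ws)} {Φ (gen r) ∙ᵗ Φ (eval ws)} {word-image (r ∷ ws)} (homo (gen r) (eval ws))
      (∙ᵗ-cong {Φ (gen r)} {gen-image r} {Φ (eval ws)} {word-image ws} (proj₂ (proj₂ cocycle) r) (Φ-eval ws))

  crossings-wd : ∀ ws vs → eval ws ≈ eval vs → ∀ u → crossings ws u ≡ crossings vs u
  crossings-wd ws vs e u =
    proj₂ (≈ᵗ-trans {word-image ws} {Φ (eval ws)} {word-image vs}
             (≈ᵗ-sym {Φ (eval ws)} {word-image ws} (Φ-eval ws))
             (≈ᵗ-trans {Φ (eval ws)} {Φ (eval vs)} {word-image vs} (Φ-cong e) (Φ-eval vs))) u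

  Deletion : List Gen → Set
  Deletion ws = Σ (List Gen) λ as → Σ Gen λ a → Σ (List Gen) λ bs → ws ≡ as ++ a ∷ bs

  deletion : ∀ ws u → crossings ws u ≡ true →
             Σ (Deletion ws) λ (as , _ , bs , _) → u ∙ eval ws ≈ eval as ∙ eval bs
  deletion []       u ()
  deletion (r ∷ ws) u odd with lem {u ≈ gen r}
  ... | yes u≈r = ([] , r , ws , refl) , (begin
        u ∙ (gen r ∙ eval ws)   ≈⟨ ≈-sym (assoc _ _ _) ⟩
        u ∙ gen r ∙ eval ws     ≈⟨ ∙-congʳ (∙-congʳ u≈r) ⟩
        gen r ∙ gen r ∙ eval ws ≈⟨ ∙-congʳ (gen-invol r) ⟩
        ε ∙ eval ws             ∎)
  ... | no _ with deletion ws (conj (gen r) u) odd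
  ...   | (as , a , bs , eq) , e = (r ∷ as , a , bs , cong (r ∷_) eq) , (begin
        u ∙ (gen r ∙ eval ws)               ≈⟨ ≈-sym (assoc _ _ _) ⟩
        u ∙ gen r ∙ eval ws                 ≈⟨ ∙-congʳ (∙-conj (gen r) u) ⟩
        gen r ∙ conj (gen r) u ∙ eval ws    ≈⟨ assoc _ _ _ ⟩
        gen r ∙ (conj (gen r) u ∙ eval ws)  ≈⟨ ∙-congˡ e ⟩
        gen r ∙ (eval as ∙ eval bs)         ≈⟨ ≈-sym (assoc _ _ _) ⟩
        gen r ∙ eval as ∙ eval bs           ∎)

-- The length function and the exchange condition: multiplying w by a
-- generator r either lengthens w by one, or is achieved by deleting one
-- letter from any word for w; which case occurs is decided by the parity
-- with which a word for w crosses r.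
module Length (lem : ExcludedMiddle 0ℓ) (C : CoxeterSystem) where
  open Coxeter C renaming (refl to ≈-refl; sym to ≈-sym; trans to ≈-trans)
  open import Algebra.Properties.Group W
  open import Relation.Binary.Reasoning.Setoid setoid
  open Classical lem
  open Conjugation W using (conj-self)
  open ReflectionCocycle lem C
  open Words C

  HasWord : Carrier → ℕ → Set
  HasWord w n = Σ (List Gen) λ ws → length ws ≡ n × w ≈ eval ws

  shortest : ∀ w → Least (HasWord w)
  shortest w = let (ws , e) = generates w in least (HasWord w) (length ws) (ws , refl , e)

  opaque
    len : Carrier → ℕ
    len w = proj₁ (shortest w)

    len-word : ∀ w → HasWord w (len w)
    len-word w = proj₁ (proj₂ (shortest w))

    len-min : ∀ {w} ws → w ≈ eval ws → len w ≤ length ws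
    len-min {w} ws e = proj₂ (proj₂ (shortest w)) (length ws) (ws , refl , e)

  isLength : ∀ w → IsLength w (len w)
  isLength w = len-word w , len-min

  isLength-unique : ∀ {w n} → IsLength w n → n ≡ len w
  isLength-unique {w} {n} ((vs , l , e) , min) =
    let (ws , l' , e') = len-word w in
    ≤-antisym (subst (n ≤_) l' (min ws e')) (subst (len w ≤_) l (len-min vs e))

  LenLt⇒< : ∀ {u v} → LenLt u v → len u < len v
  LenLt⇒< (m , n , ℓu , ℓv , m<n) = subst₂ _<_ (isLength-unique ℓu) (isLength-unique ℓv) m<n

  <⇒LenLt : ∀ {u v} → len u < len v → LenLt u v
  <⇒LenLt {u} {v} lt = len u , len v , isLength u , isLength v , lt

  len-cong : ∀ {w w'} → w ≈ w' → len w ≡ len w'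
  len-cong {w} {w'} e =
    let (ws , l , e₁) = len-word w ; (ws' , l' , e₁') = len-word w' in
    ≤-antisym (subst (len w ≤_) l' (len-min ws' (≈-trans e e₁')))
              (subst (len w' ≤_) l (len-min ws (≈-trans (≈-sym e) e₁)))

  reduced⇒additive : ∀ {g x} → Reduced g x → len (g ∙ x) ≡ len g + len x
  reduced⇒additive (a , b , ℓg , ℓx , ℓgx) =
    ≡.trans (≡.sym (isLength-unique ℓgx)) (cong₂ _+_ (isLength-unique ℓg) (isLength-unique ℓx))

  additive⇒reduced : ∀ {g x} → len (g ∙ x) ≡ len g + len x → Reduced g x
  additive⇒reduced {g} {x} eq =
    len g , len x , isLength g , isLength x , subst (IsLength (g ∙ x)) eq (isLength (g ∙ x))

  InMinRight-cong : ∀ {H w w'} → w ≈ w' → InMinRight H w → InMinRight H w'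
  InMinRight-cong e mr h Hh d =
    mr h Hh (<⇒LenLt (subst₂ _<_ (len-cong (∙-congʳ (≈-sym e))) (len-cong (≈-sym e)) (LenLt⇒< d)))

  len-∙ : ∀ a b → len (a ∙ b) ≤ len a + len b
  len-∙ a b =
    let (as , l , e) = len-word a ; (bs , l' , e') = len-word b in
    subst (len (a ∙ b) ≤_) (≡.trans (length-++ as) (cong₂ _+_ l l'))
      (len-min (as ++ bs) (≈-trans (∙-cong e e') (≈-sym (eval-++ as bs))))

  len-gen : ∀ r → len (gen r) ≤ 1
  len-gen r = len-min (r ∷ []) (≈-sym (identityʳ _))

  len-gen-∙ : ∀ r w → len (gen r ∙ w) ≤ suc (len w)
  len-gen-∙ r w = ≤-trans (len-∙ (gen r) w) (+-monoˡ-≤ (len w) (len-gen r))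

  len-∙-gen : ∀ r w → len (w ∙ gen r) ≤ suc (len w)
  len-∙-gen r w = ≤-trans (len-∙ w (gen r))
                    (subst (len w + len (gen r) ≤_) (+-comm (len w) 1) (+-monoʳ-≤ (len w) (len-gen r)))

  len-⁻¹ : ∀ w → len (w ⁻¹) ≡ len w
  len-⁻¹ w = ≤-antisym (bound w) (subst (_≤ len (w ⁻¹)) (len-cong (⁻¹-involutive w)) (bound (w ⁻¹)))
    where
    bound : ∀ v → len (v ⁻¹) ≤ len v
    bound v = let (vs , l , e) = len-word v in
      subst (len (v ⁻¹) ≤_) (≡.trans (length-reverse vs) l)
        (len-min (reverse vs) (≈-trans (⁻¹-cong e) (≈-sym (eval-reverse vs))))

  even⇒ascent : ∀ r w ws → w ≈ eval ws → crossings ws (gen r) ≡ false → len w < len (gen r ∙ w)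
  even⇒ascent r w ws e even =
    let (vs , l , e') = len-word (gen r ∙ w)
        odd-rws : crossings (r ∷ ws) (gen r) ≡ true
        odd-rws = cong₂ _xor_ (⟦⟧-true ≈-refl) (≡.trans (crossings-resp ws (conj-self (gen r))) even)
        odd-vs : crossings vs (gen r) ≡ true
        odd-vs = ≡.trans (≡.sym (crossings-wd (r ∷ ws) vs (≈-trans (∙-congˡ (≈-sym e)) e') (gen r))) odd-rws
        ((as , a , bs , eq) , e₂) = deletion vs (gen r) odd-vs
        w≈ : w ≈ eval (as ++ bs)
        w≈ = ≈-trans (≈-sym (gen-gen-∙ r w)) (≈-trans (∙-congˡ e') (≈-trans e₂ (≈-sym (eval-++ as bs))))
    in ≤-<-trans (len-min (as ++ bs) w≈)
         (subst (length (as ++ bs) <_) (≡.trans (cong length (≡.sym eq)) l) (length-delete as a bs))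

  odd⇒descent : ∀ r w ws → w ≈ eval ws → length ws ≡ len w → crossings ws (gen r) ≡ true →
                len (gen r ∙ w) < len w
  odd⇒descent r w ws e l odd =
    let ((as , a , bs , eq) , e₂) = deletion ws (gen r) odd in
    ≤-<-trans (len-min (as ++ bs) (≈-trans (∙-congˡ e) (≈-trans e₂ (≈-sym (eval-++ as bs)))))
      (subst (length (as ++ bs) <_) (≡.trans (cong length (≡.sym eq)) l) (length-delete as a bs))

  left-dichotomy : ∀ r w → len (gen r ∙ w) < len w ⊎ len w < len (gen r ∙ w)
  left-dichotomy r w with len-word w
  ... | ws , l , e with crossings ws (gen r) in eq
  ...   | true  = inj₁ (odd⇒descent r w ws e l eq)
  ...   | false = inj₂ (even⇒ascent r w ws e eq)

  left-exchange : ∀ r w ws → len (gen r ∙ w) < len w → w ≈ eval ws →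
                  Σ (Deletion ws) λ (as , _ , bs , _) → gen r ∙ eval ws ≈ eval as ∙ eval bs
  left-exchange r w ws lt e with crossings ws (gen r) in eq
  ... | true  = deletion ws (gen r) eq
  ... | false = ⊥-elim (<-asym lt (even⇒ascent r w ws e eq))

  -- right versions, through w ↦ w⁻¹
  len-gen-∙⁻¹ : ∀ r w → len (gen r ∙ w ⁻¹) ≡ len (w ∙ gen r)
  len-gen-∙⁻¹ r w = ≡.trans (len-cong (≈-sym (≈-trans (⁻¹-anti-homo-∙ w (gen r)) (∙-congʳ (gen⁻¹ r)))))
                            (len-⁻¹ _)

  right-dichotomy : ∀ r w → len (w ∙ gen r) < len w ⊎ len w < len (w ∙ gen r)
  right-dichotomy r w with left-dichotomy r (w ⁻¹)
  ... | inj₁ lt = inj₁ (subst₂ _<_ (len-gen-∙⁻¹ r w) (len-⁻¹ w) lt)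
  ... | inj₂ gt = inj₂ (subst₂ _<_ (len-⁻¹ w) (len-gen-∙⁻¹ r w) gt)

  right-exchange : ∀ r w ws → len (w ∙ gen r) < len w → w ≈ eval ws →
                   Σ (Deletion ws) λ (as , _ , bs , _) → eval ws ∙ gen r ≈ eval as ∙ eval bs
  right-exchange r w ws lt e =
    let lt' = subst₂ _<_ (≡.sym (len-gen-∙⁻¹ r w)) (≡.sym (len-⁻¹ w)) lt
        ((as , a , bs , q) , e₂) = left-exchange r (w ⁻¹) (reverse ws) lt'
                                     (≈-trans (⁻¹-cong e) (≈-sym (eval-reverse ws)))
        q' : ws ≡ reverse bs ++ a ∷ reverse as
        q' = ≡.trans (≡.sym (reverse-involutive ws)) (≡.trans (cong reverse q)
               (≡.trans (reverse-++ as (a ∷ bs))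
                        (≡.trans (cong (_++ reverse as) (unfold-reverse a bs)) (++-assoc (reverse bs) [ a ] (reverse as)))))
    in (reverse bs , a , reverse as , q') , (begin
      eval ws ∙ gen r                     ≈⟨ ∙-cong (≈-sym (⁻¹-involutive _)) (≈-sym (gen⁻¹ r)) ⟩
      eval ws ⁻¹ ⁻¹ ∙ gen r ⁻¹            ≈⟨ ≈-sym (⁻¹-anti-homo-∙ (gen r) (eval ws ⁻¹)) ⟩
      (gen r ∙ eval ws ⁻¹) ⁻¹             ≈⟨ ⁻¹-cong (∙-congˡ (≈-sym (eval-reverse ws))) ⟩
      (gen r ∙ eval (reverse ws)) ⁻¹      ≈⟨ ⁻¹-cong e₂ ⟩
      (eval as ∙ eval bs) ⁻¹              ≈⟨ ⁻¹-anti-homo-∙ (eval as) (eval bs) ⟩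
      eval bs ⁻¹ ∙ eval as ⁻¹             ≈⟨ ∙-cong (≈-sym (eval-reverse bs)) (≈-sym (eval-reverse as)) ⟩
      eval (reverse bs) ∙ eval (reverse as) ∎)

-- The central fact
-- is that for x without left descents in J and g ∈ W_J lengths add:
-- ℓ(g x) = ℓ(g) + ℓ(x).  It is proved for x of minimal length in its coset
-- W_J x by induction on a reduced J-word for g, and x without left descents
-- in J is shown to be that minimal element.
module Parabolic (lem : ExcludedMiddle 0ℓ) (C : CoxeterSystem) (J : Coxeter.Gen C → Set) where
  open Coxeter C renaming (refl to ≈-refl; sym to ≈-sym; trans to ≈-trans; reflexive to ≈-reflexive)
  open import Algebra.Properties.Group W
  open import Relation.Binary.Reasoning.Setoid setoid
  open Classical lem
  open Length lem C
  open Words C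
  open ParabolicSubgroup C J public

  All-delete : ∀ as {b} bs → All J (as ++ b ∷ bs) → All J (as ++ bs)
  All-delete as bs p = let (pas , pbs) = ++⁻ as p in ++⁺ pas (All.tail pbs)

  shorten : ∀ ws → All J ws → len (eval ws) < length ws →
            Σ (List Gen) λ vs → All J vs × eval vs ≈ eval ws × length vs < length ws
  shorten []       p        ()
  shorten (a ∷ ws) (pa ∷ pws) lt with m≤n⇒m<n∨m≡n (len-min {eval ws} ws ≈-refl)
  ... | inj₁ lt' = let (vs , pvs , e , l) = shorten ws pws lt' in a ∷ vs , pa ∷ pvs , ∙-congˡ e , s≤s l
  ... | inj₂ eqn with left-dichotomy a (eval ws)
  ...   | inj₂ gt = ⊥-elim (<⇒≱ gt (subst (len (gen a ∙ eval ws) ≤_) (≡.sym eqn) (≤-pred lt)))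
  ...   | inj₁ lt₂ with left-exchange a (eval ws) ws lt₂ ≈-refl
  ...     | (as , b , bs , q) , e₂ =
          as ++ bs , All-delete as bs (subst (All J) q pws) , ≈-trans (eval-++ as bs) (≈-sym e₂) ,
          ≤-trans (subst (length (as ++ bs) <_) (cong length (≡.sym q)) (length-delete as b bs)) (n≤1+n _)

  HasJWord : Carrier → ℕ → Set
  HasJWord g n = Σ (List Gen) λ vs → All J vs × length vs ≡ n × g ≈ eval vs

  -- every element of W_J has a reduced word with letters in J:
  -- a shortest J-word is reduced, since otherwise it could be shortened
  reduced-J-word : ∀ {g} → InWJ g → Σ (List Gen) λ vs → All J vs × g ≈ eval vs × length vs ≡ len g
  reduced-J-word {g} (ws , p , e) with least (HasJWord g) (length ws) (ws , p , refl , e)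
  ... | m , (vs , pvs , refl , e') , shortest-J with m≤n⇒m<n∨m≡n (len-min vs e')
  ...   | inj₂ eq = vs , pvs , e' , ≡.sym eq
  ...   | inj₁ lt =
          let (us , pus , e'' , l) = shorten vs pvs (subst (_< length vs) (len-cong e') lt) in
          ⊥-elim (<⇒≱ l (shortest-J (length us) (us , pus , refl , ≈-trans e' (≈-sym e''))))

  reduced-suffix : ∀ a ws → length (a ∷ ws) ≡ len (eval (a ∷ ws)) → length ws ≡ len (eval ws)
  reduced-suffix a ws l =
    ≤-antisym (≤-pred (subst (_≤ suc (len (eval ws))) (≡.sym l) (len-gen-∙ a (eval ws)))) (len-min ws ≈-refl)

  length-one : ∀ {u} → InWJ u → len u ≡ 1 → Σ Gen λ r → J r × u ≈ gen r
  length-one Pu lu with reduced-J-word Pu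
  ... | r ∷ [] , jr ∷ [] , e , _ = r , jr , ≈-trans e (identityʳ _)
  ... | []        , _ , _ , l = ⊥-elim (0≢1+n (≡.trans l lu))
  ... | _ ∷ _ ∷ _ , _ , _ , l = ⊥-elim (1+n≢0 (suc-injective (≡.trans l lu)))

  -- the only element of W_J without right descents in J is the identity:
  -- the last letter of a reduced J-word is such a descent
  no-right-descent⇒ε : ∀ {g} → InWJ g → (∀ r → J r → ¬ len (g ∙ gen r) < len g) → g ≈ ε
  no-right-descent⇒ε {g} Pg nd with reduced-J-word Pg
  ... | ws , pws , e , l with reverseView ws
  ...   | [] = e
  ...   | ini ∶ _ ∶ʳ a = ⊥-elim (nd a (All.head (proj₂ (++⁻ ini pws))) descent)
    where
    g∙a : g ∙ gen a ≈ eval ini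
    g∙a = begin
      g ∙ gen a                        ≈⟨ ∙-congʳ (≈-trans e (eval-++ ini [ a ])) ⟩
      eval ini ∙ (gen a ∙ ε) ∙ gen a   ≈⟨ assoc _ _ _ ⟩
      eval ini ∙ (gen a ∙ ε ∙ gen a)   ≈⟨ ∙-congˡ (≈-trans (∙-congʳ (identityʳ _)) (gen-invol a)) ⟩
      eval ini ∙ ε                     ≈⟨ identityʳ _ ⟩
      eval ini                         ∎
    descent : len (g ∙ gen a) < len g
    descent = ≤-<-trans (len-min ini g∙a)
                (subst (length ini <_) (≡.trans (≡.sym (length-++ ini)) l)
                  (subst (length ini <_) (+-comm 1 (length ini)) ≤-refl))

  MinimalInCoset : Carrier → Set
  MinimalInCoset x = ∀ p → InWJ p → len x ≤ len (p ∙ x)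

  -- a left descent a ∈ J of  eval ws ∙ x  (ws a J-word) deletes a letter of
  -- ws ++ xs (xs a reduced word of x): inside ws it shows that  a ∷ ws  is not
  -- reduced, inside xs it exhibits an element of W_J shortening x
  left-descent-of-product : ∀ {a x} ws → J a → All J ws → len (gen a ∙ (eval ws ∙ x)) < len (eval ws ∙ x) →
    len (eval (a ∷ ws)) < length (a ∷ ws) ⊎ (Σ Carrier λ p → InWJ p × len (p ∙ x) < len x)
  left-descent-of-product {a} {x} ws ja pws lt =
    let (xs , lx , ex) = len-word x
        ((as , b , bs , q) , e) = left-exchange a (eval ws ∙ x) (ws ++ xs) lt
                                    (≈-trans (∙-congˡ ex) (≈-sym (eval-++ ws xs)))
    in [ (λ (cs , ws≡ , bs≡) → inj₁ (≤-<-trans (len-min (as ++ cs) (left-deletion-in-prefix ws xs as bs cs ex e bs≡))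
                                        (≤-trans (subst (length (as ++ cs) <_) (cong length (≡.sym ws≡))
                                                   (length-delete as b cs)) (n≤1+n _))))
       , (λ (ds , as≡ , xs≡) → inj₂ (eval ws ⁻¹ ∙ gen a ∙ eval ws ,
                                     InWJ-∙ (InWJ-∙ (InWJ-⁻¹ (InWJ-word pws)) (InWJ-gen ja)) (InWJ-word pws) ,
                                     ≤-<-trans (len-min (ds ++ bs) (left-deletion-in-suffix ws xs as bs ds ex e as≡))
                                       (subst (length (ds ++ bs) <_) (≡.trans (cong length (≡.sym xs≡)) lx)
                                          (length-delete ds b bs))))
       ]′ (split-++ ws xs as b bs q)

  minimal⇒additive : ∀ {x} → MinimalInCoset x → ∀ ws → All J ws → length ws ≡ len (eval ws) →
                     len (eval ws ∙ x) ≡ length ws + len x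
  minimal⇒additive {x} min []       _          _ = len-cong (identityˡ x)
  minimal⇒additive {x} min (a ∷ ws) (ja ∷ pws) l with left-dichotomy a (eval ws ∙ x)
  ... | inj₂ gt = ≡.trans (len-cong (assoc _ _ _))
                    (≡.trans (≤-antisym (len-gen-∙ a _) gt)
                             (cong suc (minimal⇒additive min ws pws (reduced-suffix a ws l))))
  ... | inj₁ lt = ⊥-elim ([ <-irrefl (≡.sym l) , (λ (p , Pp , p∙x<x) → <⇒≱ p∙x<x (min p Pp)) ]′
                             (left-descent-of-product ws ja pws lt))

  coset-minimum : ∀ x → Σ Carrier λ p₀ → InWJ p₀ × MinimalInCoset (p₀ ∙ x)
  coset-minimum x =
    let Q = λ n → Σ Carrier λ p → InWJ p × len (p ∙ x) ≡ n
        (m , (p₀ , P₀ , lq) , least-m) = least Q (len (ε ∙ x)) (ε , InWJ-ε , refl)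
    in p₀ , P₀ , λ p Pp → subst (_≤ len (p ∙ (p₀ ∙ x))) (≡.sym lq)
                            (least-m _ (p ∙ p₀ , InWJ-∙ Pp P₀ , len-cong (assoc _ _ _)))

  -- x without left descents in J is the minimal element of W_J x: otherwise
  -- x = a q x₀ for the minimal x₀ and a reduced J-word a ∷ q, and a would be
  -- a left descent of x
  minLeft⇒minimal : ∀ {x} → InMinLeft J x → MinimalInCoset x
  minLeft⇒minimal {x} hx with coset-minimum x
  ... | p₀ , P₀ , min₀ with reduced-J-word (InWJ-⁻¹ P₀)
  ...   | [] , _ , p₀⁻¹≈ε , _ = λ p Pp →
          subst₂ _≤_ (len-cong (≈-sym x≈x₀)) (len-cong (∙-congˡ (≈-sym x≈x₀))) (min₀ p Pp)
    where
    x≈x₀ : x ≈ p₀ ∙ x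
    x≈x₀ = ≈-trans (≈-sym (\\-leftDividesʳ p₀ x)) (≈-trans (∙-congʳ p₀⁻¹≈ε) (identityˡ _))
  ...   | a ∷ qs , ja ∷ pqs , p₀⁻¹≈aqs , l = ⊥-elim (hx a ja (<⇒LenLt descent))
    where
    x₀ = p₀ ∙ x
    x≈aqsx₀ : x ≈ gen a ∙ eval qs ∙ x₀
    x≈aqsx₀ = ≈-trans (≈-sym (\\-leftDividesʳ p₀ x)) (∙-congʳ p₀⁻¹≈aqs)
    a∙x : gen a ∙ x ≈ eval qs ∙ x₀
    a∙x = ≈-trans (∙-congˡ (≈-trans x≈aqsx₀ (assoc _ _ _))) (gen-gen-∙ a _)
    reduced : length (a ∷ qs) ≡ len (eval (a ∷ qs))
    reduced = ≡.trans l (len-cong p₀⁻¹≈aqs)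
    descent : len (gen a ∙ x) < len x
    descent = subst₂ _<_
      (≡.trans (≡.sym (minimal⇒additive min₀ qs pqs (reduced-suffix a qs reduced))) (len-cong (≈-sym a∙x)))
      (≡.trans (≡.sym (minimal⇒additive min₀ (a ∷ qs) (ja ∷ pqs) reduced)) (len-cong (≈-sym x≈aqsx₀)))
      ≤-refl

  length-additive : ∀ {x g} → InMinLeft J x → InWJ g → len (g ∙ x) ≡ len g + len x
  length-additive {x} {g} hx Pg =
    let (ws , pws , e , l) = reduced-J-word Pg in
    ≡.trans (len-cong (∙-congʳ e))
      (≡.trans (minimal⇒additive (minLeft⇒minimal hx) ws pws (≡.trans l (len-cong e))) (cong (_+ len x) l))

  -- a right descent h of  g ∙ x  (g ∈ W_J) deletes a letter of ws ++ xs, for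
  -- a J-word ws of g and a reduced word xs of x: inside xs it makes h a right
  -- descent of x, inside ws it shows  g ∙ x ∙ h ∈ W_J x
  right-descent-of-product : ∀ {g h x} → InWJ g → len (g ∙ x ∙ gen h) < len (g ∙ x) →
    len (x ∙ gen h) < len x ⊎ (Σ Carrier λ g' → InWJ g' × g ∙ x ∙ gen h ≈ g' ∙ x)
  right-descent-of-product {g} {h} {x} (ws , pws , g≈ws) lt =
    let (xs , lx , ex) = len-word x
        ((as , b , bs , q) , e) = right-exchange h (g ∙ x) (ws ++ xs) lt
                                     (≈-trans (∙-cong g≈ws ex) (≈-sym (eval-++ ws xs)))
    in [ (λ (cs , ws≡ , bs≡) → inj₂ (eval (as ++ cs) , InWJ-word (All-delete as cs (subst (All J) ws≡ pws)) ,
                                       ≈-trans (∙-congʳ (∙-congʳ g≈ws)) (right-deletion-in-prefix ws xs as bs cs ex e bs≡)))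
       , (λ (ds , as≡ , xs≡) → inj₁ (≤-<-trans (len-min (ds ++ bs) (right-deletion-in-suffix ws xs as bs ds ex e as≡))
                                       (subst (length (ds ++ bs) <_) (≡.trans (cong length (≡.sym xs≡)) lx)
                                          (length-delete ds b bs))))
       ]′ (split-++ ws xs as b bs q)

-- If some h ∈ H is a right descent of x it is one of every
-- g·x, and the intersection is empty.
module Proposition3p2 (lem : ExcludedMiddle 0ℓ) (C : CoxeterSystem) where
  open Coxeter C renaming (refl to ≈-refl; sym to ≈-sym; trans to ≈-trans)
  open import Algebra.Properties.Group W
  open Length lem C

  module Coset (H : Gen → Set) (s t : Gen) (x : Carrier) (hx : InMinLeft (Pair s t) x) where
    open Parabolic lem C (Pair s t)

    I : Carrier → Set
    I w = InDotCoset s t x w × InMinRight H w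

    Outcome : Set
    Outcome = SameSet I (λ _ → ⊥)
            ⊎ SameSet I (λ w → w ≈ x)
            ⊎ SameSet I (InDotCosetNoDR s t t x)
            ⊎ SameSet I (InDotCosetNoDR s t s x)
            ⊎ SameSet I (InDotCoset s t x)

    XHasDescentInH : Set
    XHasDescentInH = Σ Gen λ h → H h × InDR h x

    descent-inherited : ∀ {g h} → Reduced g x → InDR h x → InDR h (g ∙ x)
    descent-inherited {g} {h} red d =
      <⇒LenLt (subst (_< len (g ∙ x)) (len-cong (≈-sym (assoc g x (gen h))))
                (≤-<-trans (len-∙ g (x ∙ gen h))
                   (subst (len g + len (x ∙ gen h) <_) (≡.sym (reduced⇒additive red))
                      (+-monoʳ-< (len g) (LenLt⇒< d)))))

    empty-case : XHasDescentInH → SameSet I (λ _ → ⊥)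
    empty-case (h , Hh , d) w =
      (λ { ((g , _ , w≈gx , red) , mr) → InMinRight-cong w≈gx mr h Hh (descent-inherited red d) }) , ⊥-elim

    Hits : Gen → Set
    Hits r = Σ Gen λ h → H h × x ∙ gen h ∙ x ⁻¹ ≈ gen r

    Good : Carrier → Set
    Good g = ∀ r → Pair s t r → Hits r → ¬ len (g ∙ gen r) < len g

    -- if x h x⁻¹ = r ∈ {s,t} then  g x h = (g r)·x  has length ℓ(g r) + ℓ(x)
    hit-length : ∀ {g h r} → InWJ g → Pair s t r → x ∙ gen h ∙ x ⁻¹ ≈ gen r →
                 len (g ∙ x ∙ gen h) ≡ len (g ∙ gen r) + len x
    hit-length {g} {h} {r} Pg jr e = ≡.trans (len-cong g∙x∙h) (length-additive hx (InWJ-∙ Pg (InWJ-gen jr)))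
      where
      g∙x∙h : g ∙ x ∙ gen h ≈ g ∙ gen r ∙ x
      g∙x∙h = ≈-trans (assoc _ _ _)
                (≈-trans (∙-congˡ (≈-trans (≈-sym (//-rightDividesˡ x (x ∙ gen h))) (∙-congʳ e)))
                         (≈-sym (assoc _ _ _)))

    -- if h is no right descent of x and  g x h = g' x  with g, g' ∈ W_{s,t},
    -- then u = x h x⁻¹ = g⁻¹ g' ∈ W_{s,t} has length ℓ(x h) − ℓ(x) = 1,
    -- so it is s or t
    conjugate-is-generator : ∀ {g g' h} → InWJ g → InWJ g' → ¬ len (x ∙ gen h) < len x →
      g ∙ x ∙ gen h ≈ g' ∙ x → Σ Gen λ r → Pair s t r × x ∙ gen h ∙ x ⁻¹ ≈ gen r
    conjugate-is-generator {g} {g'} {h} Pg Pg' ascent g∙x∙h = length-one Pu ℓu≡1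
      where
      u = x ∙ gen h ∙ x ⁻¹
      u∙x : u ∙ x ≈ x ∙ gen h
      u∙x = //-rightDividesˡ x (x ∙ gen h)
      g∙u : g ∙ u ≈ g'
      g∙u = ∙-cancelʳ x _ _ (≈-trans (assoc _ _ _) (≈-trans (∙-congˡ u∙x) (≈-trans (≈-sym (assoc _ _ _)) g∙x∙h)))
      Pu : InWJ u
      Pu = InWJ-cong (≈-trans (∙-congˡ (≈-sym g∙u)) (\\-leftDividesʳ g u)) (InWJ-∙ (InWJ-⁻¹ Pg) Pg')
      ℓxh : len (x ∙ gen h) ≡ suc (len x)
      ℓxh = [ (λ lt → ⊥-elim (ascent lt)) , ≤-antisym (len-∙-gen h x) ]′ (right-dichotomy h x)
      ℓu≡1 : len u ≡ 1
      ℓu≡1 = +-cancelʳ-≡ (len x) (len u) 1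
               (≡.trans (≡.sym (length-additive hx Pu)) (≡.trans (len-cong u∙x) ℓxh))

    good-of-minRight : ∀ {g} → InWJ g → InMinRight H (g ∙ x) → Good g
    good-of-minRight Pg mr r jr (h , Hh , e) lt =
      mr h Hh (<⇒LenLt (subst₂ _<_ (≡.sym (hit-length Pg jr e)) (≡.sym (length-additive hx Pg))
                          (+-monoˡ-< (len x) lt)))

    -- descent criterion, backward: a right descent h ∈ H of g·x comes either
    -- from x (excluded) or from a hit right descent of g
    minRight-of-good : ∀ {g} → ¬ XHasDescentInH → InWJ g → Good g → InMinRight H (g ∙ x)
    minRight-of-good nd Pg good h Hh d =
      [ (λ x∙h<x → nd (h , Hh , <⇒LenLt x∙h<x))
      , (λ (g' , Pg' , g∙x∙h) →
           let (r , jr , e) = conjugate-is-generator Pg Pg' (λ lt → nd (h , Hh , <⇒LenLt lt)) g∙x∙h in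
           good r jr (h , Hh , e)
             (+-cancelʳ-< (len x) _ _ (subst₂ _<_ (hit-length Pg jr e) (length-additive hx Pg) (LenLt⇒< d))))
      ]′ (right-descent-of-product Pg (LenLt⇒< d))

    I⇒good : ∀ {w} → I w → Σ Carrier λ g → InWJ g × Good g × IsDot w g x
    I⇒good ((g , Pg , (w≈gx , red)) , mr) = g , Pg , good-of-minRight Pg (InMinRight-cong w≈gx mr) , w≈gx , red

    good⇒I : ∀ {w g} → ¬ XHasDescentInH → InWJ g → Good g → IsDot w g x → I w
    good⇒I nd Pg good (w≈gx , red) =
      (_ , Pg , w≈gx , red) , InMinRight-cong (≈-sym w≈gx) (minRight-of-good nd Pg good)

    no-hit-case : ¬ XHasDescentInH → ¬ Hits s → ¬ Hits t → SameSet I (InDotCoset s t x)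
    no-hit-case nd ns nt w = proj₁ , λ (g , Pg , dot) → good⇒I nd Pg all-good dot
      where
      all-good : ∀ {g} → Good g
      all-good _ (inj₁ refl) hs = ⊥-elim (ns hs)
      all-good _ (inj₂ refl) ht = ⊥-elim (nt ht)

    one-hit-case : ¬ XHasDescentInH → ∀ r → Pair s t r → Hits r → (∀ r' → Pair s t r' → Hits r' → r' ≡ r) →
                   SameSet I (InDotCosetNoDR s t r x)
    one-hit-case nd r jr hr only-r w =
      (λ i → let (g , Pg , good , dot) = I⇒good i in g , Pg , (λ d → good r jr hr (LenLt⇒< d)) , dot) ,
      (λ (g , Pg , ¬dr , dot) → good⇒I nd Pg
          (λ r' jr' hr' lt → ¬dr (<⇒LenLt (subst (λ q → len (g ∙ gen q) < len g) (only-r r' jr' hr') lt))) dot)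

    only-s : ¬ Hits t → ∀ r → Pair s t r → Hits r → r ≡ s
    only-s nt _ (inj₁ refl) _  = refl
    only-s nt _ (inj₂ refl) ht = ⊥-elim (nt ht)

    only-t : ¬ Hits s → ∀ r → Pair s t r → Hits r → r ≡ t
    only-t ns _ (inj₁ refl) hs = ⊥-elim (ns hs)
    only-t ns _ (inj₂ refl) _  = refl

    -- both are hit: only g = 1 is good
    two-hit-case : ¬ XHasDescentInH → Hits s → Hits t → SameSet I (λ w → w ≈ x)
    two-hit-case nd hs ht w =
      (λ i → let (g , Pg , good , w≈gx , _) = I⇒good i in
             ≈-trans w≈gx (≈-trans (∙-congʳ (no-right-descent⇒ε Pg (λ r jr → good r jr (hit r jr)))) (identityˡ x))) ,
      (λ w≈x → (ε , InWJ-ε , ≈-trans w≈x (≈-sym (identityˡ x)) , additive⇒reduced (length-additive hx InWJ-ε)) ,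
               InMinRight-cong (≈-sym w≈x) (λ h Hh d → nd (h , Hh , d)))
      where
      hit : ∀ r → Pair s t r → Hits r
      hit _ (inj₁ refl) = hs
      hit _ (inj₂ refl) = ht

-- Excluded middle decides whether x has a right descent in H and which of
-- s, t are hit; each answer selects one of the five cases.
proposition3p2 : ExcludedMiddle 0ℓ → (C : CoxeterSystem) →
    let open Coxeter C in
    (H : Gen → Set) (s t : Gen) → s ≢ t →
    (x : Carrier) → InMinLeft (Pair s t) x →
    let I = λ w → InDotCoset s t x w × InMinRight H w in
    SameSet I (λ _ → ⊥)
    ⊎ SameSet I (λ w → w ≈ x)
    ⊎ SameSet I (InDotCosetNoDR s t t x)
    ⊎ SameSet I (InDotCosetNoDR s t s x)
    ⊎ SameSet I (InDotCoset s t x)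
proposition3p2 lem C H s t _ x hx = classify lem lem lem
  where
  open Proposition3p2.Coset lem C H s t x hx
  classify : Dec XHasDescentInH → Dec (Hits s) → Dec (Hits t) → Outcome
  classify (yes d)  _        _        = inj₁ (empty-case d)
  classify (no nd)  (yes hs) (yes ht) = inj₂ (inj₁ (two-hit-case nd hs ht))
  classify (no nd)  (no ns)  (yes ht) = inj₂ (inj₂ (inj₁ (one-hit-case nd t (inj₂ refl) ht (only-t ns))))
  classify (no nd)  (yes hs) (no nt)  = inj₂ (inj₂ (inj₂ (inj₁ (one-hit-case nd s (inj₁ refl) hs (only-s nt)))))
  classify (no nd)  (no ns)  (no nt)  = inj₂ (inj₂ (inj₂ (inj₂ (no-hit-case nd ns nt))))
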